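{- For every bunch $\Delta$ and formula $\varphi$, if $[\![\lceil\Delta\rceil]\!]\subseteq[\![\varphi]\!]$ holds in $\mathcal C$, then $\Delta\vdash_{\mathsf{cf}}\varphi$.
   Context: Formulas of BI: $\varphi,\psi ::= \top \mid \bot \mid \varphi\wedge\psi \mid \varphi\vee\psi \mid \varphi\to\psi \mid \mathsf{emp} \mid \varphi * \psi \mid \varphi \mathrel{ -\!\!*} \psi \mid a$ ($a\in\mathrm{Atom}$). Bunches: $\Delta ::= \varphi \mid \varnothing_m \mid \varnothing_a \mid \Delta , \Delta \mid \Delta ; \Delta$. A bunched context $\Delta(-)$ is a bunch with one hole; $\Delta(\Gamma)$ fills it. Bunch equivalence $\equiv$: least equivalence relation, closed under bunched contexts, making "$,$" commutative and associative with unit $\varnothing_m$ and "$;$" commutative and associative with unit $\varnothing_a$. The BI sequent calculus: (ax) $a\vdash a$; (equiv) from $\Delta'\vdash\varphi$, $\Delta\equiv\Delta'$ infer $\Delta\vdash\varphi$; (W;) from $\Delta(\Delta_1)\vdash\varphi$ infer $\Delta(\Delta_1;\Delta_2)\vdash\varphi$; (C;) from $\Delta(\Delta_1;\Delta_1)\vdash\varphi$ infer $\Delta(\Delta_1)\vdash\varphi$; (cut) from $\Delta'\vdash A$, $\Delta(A)\vdash B$ infer $\Delta(\Delta')\vdash B$; (empR) $\varnothing_m\vdash\mathsf{emp}$; (empL) from $\Delta(\varnothing_m)\vdash\varphi$ infer $\Delta(\mathsf{emp})\vdash\varphi$; (*R) from $\Delta_1\vdash\varphi$, $\Delta_2\vdash\psi$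 infer $\Delta_1,\Delta_2\vdash\varphi*\psi$; (*L) from $\Delta(\varphi,\psi)\vdash\chi$ infer $\Delta(\varphi*\psi)\vdash\chi$; ($-\!*$R) from $\Delta,\varphi\vdash\psi$ infer $\Delta\vdash\varphi\mathrel{ -\!\!*}\psi$; ($-\!*$L) from $\Delta_1\vdash\varphi$, $\Delta(\Delta_2,\psi)\vdash\chi$ infer $\Delta((\Delta_1,\Delta_2),\varphi\mathrel{ -\!\!*}\psi)\vdash\chi$; ($\top$R) $\varnothing_a\vdash\top$; ($\top$L) from $\Delta(\varnothing_a)\vdash\varphi$ infer $\Delta(\top)\vdash\varphi$; ($\wedge$R) from $\Delta_1\vdash\varphi$, $\Delta_2\vdash\psi$ infer $\Delta_1;\Delta_2\vdash\varphi\wedge\psi$; ($\wedge$L) from $\Delta(\varphi;\psi)\vdash\chi$ infer $\Delta(\varphi\wedge\psi)\vdash\chi$; ($\to$R) from $\Delta;\varphi\vdash\psi$ infer $\Delta\vdash\varphi\to\psi$; ($\to$L) from $\Delta_1\vdash\varphi$, $\Delta(\Delta_2;\psi)\vdash\chi$ infer $\Delta((\Delta_1;\Delta_2);\varphi\to\psi)\vdash\chi$; ($\bot$L) $\Delta(\bot)\vdash\varphi$; ($\vee$R1/2) from $\Delta\vdash\varphi$ (resp. $\Delta\vdash\psi$) infer $\Delta\vdash\varphi\vee\psi$; ($\vee$L) from $\Delta(\varphi)\vdash\chi$, $\Delta(\psi)\vdash\chi$ infer $\Delta(\varphi\vee\psi)\vdash\chi$. $\Delta\vdash_{\mathsf{cf}}\varphi$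 means derivable without (cut). $\lceil\Delta\rceil$ is the formula obtained from $\Delta$ by replacing "$,$" by $*$, "$;$" by $\wedge$, $\varnothing_m$ by $\mathsf{emp}$, $\varnothing_a$ by $\top$. Let $\mathrm{Bunch}$ be the set of bunches modulo $\equiv$. For a formula $\varphi$ let $D(\varphi)=\{\Delta\in\mathrm{Bunch}\mid \Delta\vdash_{\mathsf{cf}}\varphi\}$. For $X\subseteq\mathrm{Bunch}$ let $\mathrm{cl}(X)=\bigcap\{D(\varphi)\mid X\subseteq D(\varphi)\}$, and let $\mathcal C=\{X\subseteq\mathrm{Bunch}\mid X=\mathrm{cl}(X)\}$. On $\mathcal C$ define: $\mathsf{emp}=\mathrm{cl}(\{\varnothing_m\})$, $\top=\mathrm{Bunch}$, $\bot=\mathrm{cl}(\emptyset)$, $X\vee Y=\mathrm{cl}(X\cup Y)$, $X\wedge Y=X\cap Y$, $X*Y=\mathrm{cl}(\{(\Delta,\Delta')\mid\Delta\in X,\Delta'\in Y\})$, $X\mathrel{ -\!\!*}Y=\{\Delta\mid\forall\Delta'\in X.\ (\Delta,\Delta')\in Y\}$, $X\to Y=\{\Delta\mid\forall\Delta'\in X.\ (\Delta;\Delta')\in Y\}$. Formulas are interpreted in $\mathcal C$ homomorphically via these operations, with atoms interpreted as $[\![a]\!]=D(a)$. -}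

module Defs where

open import Data.Product using (Σ; _×_; ∃)
open import Data.Sum using (_⊎_)
open import Data.Unit using (⊤)
open import Data.Empty using (⊥)

data Formula (Atom : Set) : Set where
  top  : Formula Atom
  bot  : Formula Atom
  _∧f_ : Formula Atom → Formula Atom → Formula Atom
  _∨f_ : Formula Atom → Formula Atom → Formula Atom
  _⇒f_ : Formula Atom → Formula Atom → Formula Atom
  emp  : Formula Atom
  _∗f_ : Formula Atom → Formula Atom → Formula Atom
  _-∗_ : Formula Atom → Formula Atom → Formula Atom
  atom : Atom → Formula Atom

-- Bunches:  fm φ | ∅m | ∅a | Δ ,ₘ Δ  (the paper's ",") | Δ ⨾ Δ  (the paper's ";")

infixr 5 _,ₘ_
infixr 4 _⨾_

data Bunch (Atom : Set) : Set where
  fm   : Formula Atom → Bunch Atom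
  ∅m   : Bunch Atom
  ∅a   : Bunch Atom
  _,ₘ_ : Bunch Atom → Bunch Atom → Bunch Atom
  _⨾_  : Bunch Atom → Bunch Atom → Bunch Atom

data Ctx (Atom : Set) : Set where
  hole : Ctx Atom
  _,ₘl_ : Ctx Atom → Bunch Atom → Ctx Atom
  _,ₘr_ : Bunch Atom → Ctx Atom → Ctx Atom
  _⨾l_  : Ctx Atom → Bunch Atom → Ctx Atom
  _⨾r_  : Bunch Atom → Ctx Atom → Ctx Atom

-- Filling the hole: C [ Γ ] is the paper's Δ(Γ)
_[_] : ∀ {Atom} → Ctx Atom → Bunch Atom → Bunch Atom
hole      [ Γ ] = Γ
(C ,ₘl Δ) [ Γ ] = (C [ Γ ]) ,ₘ Δ
(Δ ,ₘr C) [ Γ ] = Δ ,ₘ (C [ Γ ])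
(C ⨾l Δ)  [ Γ ] = (C [ Γ ]) ⨾ Δ
(Δ ⨾r C)  [ Γ ] = Δ ⨾ (C [ Γ ])

infix 3 _≡b_
data _≡b_ {Atom : Set} : Bunch Atom → Bunch Atom → Set where
  ≡b-refl  : ∀ {Δ} → Δ ≡b Δ
  ≡b-sym   : ∀ {Δ Γ} → Δ ≡b Γ → Γ ≡b Δ
  ≡b-trans : ∀ {Δ Γ Θ} → Δ ≡b Γ → Γ ≡b Θ → Δ ≡b Θ
  ≡b-ctx   : ∀ (C : Ctx Atom) {Δ Γ} → Δ ≡b Γ → C [ Δ ] ≡b C [ Γ ]
  ,-comm   : ∀ {Δ Γ} → (Δ ,ₘ Γ) ≡b (Γ ,ₘ Δ)
  ,-assoc  : ∀ {Δ Γ Θ} → ((Δ ,ₘ Γ) ,ₘ Θ) ≡b (Δ ,ₘ (Γ ,ₘ Θ))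
  ,-unit   : ∀ {Δ} → (Δ ,ₘ ∅m) ≡b Δ
  ⨾-comm   : ∀ {Δ Γ} → (Δ ⨾ Γ) ≡b (Γ ⨾ Δ)
  ⨾-assoc  : ∀ {Δ Γ Θ} → ((Δ ⨾ Γ) ⨾ Θ) ≡b (Δ ⨾ (Γ ⨾ Θ))
  ⨾-unit   : ∀ {Δ} → (Δ ⨾ ∅a) ≡b Δ

infix 2 _⊢cf_
data _⊢cf_ {Atom : Set} : Bunch Atom → Formula Atom → Set where
  ax    : ∀ {a} → fm (atom a) ⊢cf atom a
  equiv : ∀ {Δ Δ' φ} → Δ' ⊢cf φ → Δ ≡b Δ' → Δ ⊢cf φ
  W⨾    : ∀ (C : Ctx Atom) {Δ₁ Δ₂ φ} → C [ Δ₁ ] ⊢cf φ → C [ Δ₁ ⨾ Δ₂ ] ⊢cf φ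
  C⨾    : ∀ (C : Ctx Atom) {Δ₁ φ} → C [ Δ₁ ⨾ Δ₁ ] ⊢cf φ → C [ Δ₁ ] ⊢cf φ
  empR  : ∅m ⊢cf emp
  empL  : ∀ (C : Ctx Atom) {φ} → C [ ∅m ] ⊢cf φ → C [ fm emp ] ⊢cf φ
  ∗R    : ∀ {Δ₁ Δ₂ φ ψ} → Δ₁ ⊢cf φ → Δ₂ ⊢cf ψ → (Δ₁ ,ₘ Δ₂) ⊢cf (φ ∗f ψ)
  ∗L    : ∀ (C : Ctx Atom) {φ ψ χ} → C [ fm φ ,ₘ fm ψ ] ⊢cf χ → C [ fm (φ ∗f ψ) ] ⊢cf χ
  -∗R   : ∀ {Δ φ ψ} → (Δ ,ₘ fm φ) ⊢cf ψ → Δ ⊢cf (φ -∗ ψ)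
  -∗L   : ∀ (C : Ctx Atom) {Δ₁ Δ₂ φ ψ χ} → Δ₁ ⊢cf φ → C [ Δ₂ ,ₘ fm ψ ] ⊢cf χ
          → C [ (Δ₁ ,ₘ Δ₂) ,ₘ fm (φ -∗ ψ) ] ⊢cf χ
  ⊤R    : ∅a ⊢cf top
  ⊤L    : ∀ (C : Ctx Atom) {φ} → C [ ∅a ] ⊢cf φ → C [ fm top ] ⊢cf φ
  ∧R    : ∀ {Δ₁ Δ₂ φ ψ} → Δ₁ ⊢cf φ → Δ₂ ⊢cf ψ → (Δ₁ ⨾ Δ₂) ⊢cf (φ ∧f ψ)
  ∧L    : ∀ (C : Ctx Atom) {φ ψ χ} → C [ fm φ ⨾ fm ψ ] ⊢cf χ → C [ fm (φ ∧f ψ) ] ⊢cf χ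
  ⇒R    : ∀ {Δ φ ψ} → (Δ ⨾ fm φ) ⊢cf ψ → Δ ⊢cf (φ ⇒f ψ)
  ⇒L    : ∀ (C : Ctx Atom) {Δ₁ Δ₂ φ ψ χ} → Δ₁ ⊢cf φ → C [ Δ₂ ⨾ fm ψ ] ⊢cf χ
          → C [ (Δ₁ ⨾ Δ₂) ⨾ fm (φ ⇒f ψ) ] ⊢cf χ
  ⊥L    : ∀ (C : Ctx Atom) {φ} → C [ fm bot ] ⊢cf φ
  ∨R1   : ∀ {Δ φ ψ} → Δ ⊢cf φ → Δ ⊢cf (φ ∨f ψ)
  ∨R2   : ∀ {Δ φ ψ} → Δ ⊢cf ψ → Δ ⊢cf (φ ∨f ψ)
  ∨L    : ∀ (C : Ctx Atom) {φ ψ χ} → C [ fm φ ] ⊢cf χ → C [ fm ψ ] ⊢cf χ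
          → C [ fm (φ ∨f ψ) ] ⊢cf χ

⌈_⌉ : ∀ {Atom} → Bunch Atom → Formula Atom
⌈ fm φ ⌉   = φ
⌈ ∅m ⌉     = emp
⌈ ∅a ⌉     = top
⌈ Δ ,ₘ Γ ⌉ = ⌈ Δ ⌉ ∗f ⌈ Γ ⌉
⌈ Δ ⨾ Γ ⌉  = ⌈ Δ ⌉ ∧f ⌈ Γ ⌉

-- The algebra 𝒞.  Sets of bunches modulo ≡ are represented as predicates
-- on raw bunches; all sets used below are ≡b-closed (D φ is, by (equiv),
-- hence so is every cl X).

BSet : Set → Set₁
BSet Atom = Bunch Atom → Set

_⊆_ : ∀ {Atom} → BSet Atom → BSet Atom → Set
X ⊆ Y = ∀ Δ → X Δ → Y Δ

D : ∀ {Atom} → Formula Atom → BSet Atom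
D φ Δ = Δ ⊢cf φ

cl : ∀ {Atom} → BSet Atom → BSet Atom
cl X Δ = ∀ φ → X ⊆ D φ → D φ Δ

empC : ∀ {Atom} → BSet Atom
empC = cl (λ Δ → Δ ≡b ∅m)

topC : ∀ {Atom} → BSet Atom
topC _ = ⊤

botC : ∀ {Atom} → BSet Atom
botC = cl (λ _ → ⊥)

_∨C_ : ∀ {Atom} → BSet Atom → BSet Atom → BSet Atom
(X ∨C Y) = cl (λ Δ → X Δ ⊎ Y Δ)

_∧C_ : ∀ {Atom} → BSet Atom → BSet Atom → BSet Atom
(X ∧C Y) Δ = X Δ × Y Δ

_∗C_ : ∀ {Atom} → BSet Atom → BSet Atom → BSet Atom
(X ∗C Y) = cl (λ Γ → Σ _ λ Δ → Σ _ λ Δ' → X Δ × Y Δ' × (Γ ≡b (Δ ,ₘ Δ')))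

_-∗C_ : ∀ {Atom} → BSet Atom → BSet Atom → BSet Atom
(X -∗C Y) Δ = ∀ Δ' → X Δ' → Y (Δ ,ₘ Δ')

_⇒C_ : ∀ {Atom} → BSet Atom → BSet Atom → BSet Atom
(X ⇒C Y) Δ = ∀ Δ' → X Δ' → Y (Δ ⨾ Δ')

⟦_⟧ : ∀ {Atom} → Formula Atom → BSet Atom
⟦ top ⟧    = topC
⟦ bot ⟧    = botC
⟦ φ ∧f ψ ⟧ = ⟦ φ ⟧ ∧C ⟦ ψ ⟧
⟦ φ ∨f ψ ⟧ = ⟦ φ ⟧ ∨C ⟦ ψ ⟧
⟦ φ ⇒f ψ ⟧ = ⟦ φ ⟧ ⇒C ⟦ ψ ⟧
⟦ emp ⟧    = empC
⟦ φ ∗f ψ ⟧ = ⟦ φ ⟧ ∗C ⟦ ψ ⟧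
⟦ φ -∗ ψ ⟧ = ⟦ φ ⟧ -∗C ⟦ ψ ⟧
⟦ atom a ⟧ = D (atom a)

-- Every interpreted set ⟦ φ ⟧ is closed under bunch equivalence, weakening and the
-- left rules (∧L), (⇒L), (-∗L): closed sets are intersections of sets D χ, which are
-- closed because the rules are rules of the calculus, and ∧C, ⇒C, -∗C preserve
-- the property.  With this, induction on φ shows fm φ ∈ ⟦ φ ⟧ ⊆ D φ, and induction
-- on Δ shows Δ ∈ ⟦ ⌈ Δ ⌉ ⟧.  So a bunch Δ with ⟦ ⌈ Δ ⌉ ⟧ ⊆ ⟦ φ ⟧ lies in
-- ⟦ φ ⟧ ⊆ D φ, i.e. Δ ⊢cf φ.
module Submission where

open import Defs
open import Data.Product using (_,_)
open import Data.Sum using (inj₁; inj₂)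
open import Data.Unit using (tt)

module _ {Atom : Set} where

  record LeftClosed (X : BSet Atom) : Set where
    field
      ≡b-closed  : ∀ {Δ Δ'} → X Δ' → Δ ≡b Δ' → X Δ
      weaken     : ∀ (C : Ctx Atom) {Δ₁ Δ₂} → X (C [ Δ₁ ]) → X (C [ Δ₁ ⨾ Δ₂ ])
      ∧L-closed  : ∀ (C : Ctx Atom) {φ ψ} → X (C [ fm φ ⨾ fm ψ ]) → X (C [ fm (φ ∧f ψ) ])
      ⇒L-closed  : ∀ (C : Ctx Atom) {Δ₁ Δ₂ φ ψ} → Δ₁ ⊢cf φ → X (C [ Δ₂ ⨾ fm ψ ])
                   → X (C [ (Δ₁ ⨾ Δ₂) ⨾ fm (φ ⇒f ψ) ])
      -∗L-closed : ∀ (C : Ctx Atom) {Δ₁ Δ₂ φ ψ} → Δ₁ ⊢cf φ → X (C [ Δ₂ ,ₘ fm ψ ])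
                   → X (C [ (Δ₁ ,ₘ Δ₂) ,ₘ fm (φ -∗ ψ) ])

    weakenˡ : ∀ {Δ Γ} → X Δ → X (Δ ⨾ Γ)
    weakenˡ = weaken hole

    weakenʳ : ∀ {Δ Γ} → X Δ → X (Γ ⨾ Δ)
    weakenʳ x = ≡b-closed (weakenˡ x) ⨾-comm

    ⇒-apply : ∀ {Δ φ ψ} → Δ ⊢cf φ → X (fm ψ) → X (fm (φ ⇒f ψ) ⨾ Δ)
    ⇒-apply {Δ} {φ} {ψ} d x =
      ≡b-closed (⇒L-closed hole {Δ₂ = ∅a} d (≡b-closed x (≡b-trans ⨾-comm ⨾-unit)))
                (≡b-trans ⨾-comm (≡b-ctx (hole ⨾l fm (φ ⇒f ψ)) (≡b-sym ⨾-unit)))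

    -∗-apply : ∀ {Δ φ ψ} → Δ ⊢cf φ → X (fm ψ) → X (fm (φ -∗ ψ) ,ₘ Δ)
    -∗-apply {Δ} {φ} {ψ} d x =
      ≡b-closed (-∗L-closed hole {Δ₂ = ∅m} d (≡b-closed x (≡b-trans ,-comm ,-unit)))
                (≡b-trans ,-comm (≡b-ctx (hole ,ₘl fm (φ -∗ ψ)) (≡b-sym ,-unit)))

  open LeftClosed

  D-leftClosed : ∀ χ → LeftClosed (D χ)
  D-leftClosed χ = record
    { ≡b-closed  = equiv
    ; weaken     = λ C → W⨾ C
    ; ∧L-closed  = λ C → ∧L C
    ; ⇒L-closed  = λ C → ⇒L C
    ; -∗L-closed = λ C → -∗L C
    }

  ⋂-leftClosed : ∀ {I : Set} (X : I → BSet Atom) →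
                 (∀ i → LeftClosed (X i)) → LeftClosed (λ Δ → ∀ i → X i Δ)
  ⋂-leftClosed X lc = record
    { ≡b-closed  = λ x e i → ≡b-closed (lc i) (x i) e
    ; weaken     = λ C x i → weaken (lc i) C (x i)
    ; ∧L-closed  = λ C x i → ∧L-closed (lc i) C (x i)
    ; ⇒L-closed  = λ C d x i → ⇒L-closed (lc i) C d (x i)
    ; -∗L-closed = λ C d x i → -∗L-closed (lc i) C d (x i)
    }

  cl-leftClosed : ∀ X → LeftClosed (cl X)
  cl-leftClosed X =
    ⋂-leftClosed (λ χ Δ → X ⊆ D χ → D χ Δ) λ χ →
    ⋂-leftClosed (λ _ → D χ) λ _ → D-leftClosed χ

  ⨾-frame-leftClosed : ∀ {Y} Γ → LeftClosed Y → LeftClosed (λ Δ → Y (Δ ⨾ Γ))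
  ⨾-frame-leftClosed Γ lc = record
    { ≡b-closed  = λ y e → ≡b-closed lc y (≡b-ctx (hole ⨾l Γ) e)
    ; weaken     = λ C → weaken lc (C ⨾l Γ)
    ; ∧L-closed  = λ C → ∧L-closed lc (C ⨾l Γ)
    ; ⇒L-closed  = λ C → ⇒L-closed lc (C ⨾l Γ)
    ; -∗L-closed = λ C → -∗L-closed lc (C ⨾l Γ)
    }

  ,-frame-leftClosed : ∀ {Y} Γ → LeftClosed Y → LeftClosed (λ Δ → Y (Δ ,ₘ Γ))
  ,-frame-leftClosed Γ lc = record
    { ≡b-closed  = λ y e → ≡b-closed lc y (≡b-ctx (hole ,ₘl Γ) e)
    ; weaken     = λ C → weaken lc (C ,ₘl Γ)
    ; ∧L-closed  = λ C → ∧L-closed lc (C ,ₘl Γ)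
    ; ⇒L-closed  = λ C → ⇒L-closed lc (C ,ₘl Γ)
    ; -∗L-closed = λ C → -∗L-closed lc (C ,ₘl Γ)
    }

  topC-leftClosed : LeftClosed topC
  topC-leftClosed = record
    { ≡b-closed  = λ _ _ → tt
    ; weaken     = λ _ _ → tt
    ; ∧L-closed  = λ _ _ → tt
    ; ⇒L-closed  = λ _ _ _ → tt
    ; -∗L-closed = λ _ _ _ → tt
    }

  ∧C-leftClosed : ∀ {X Y} → LeftClosed X → LeftClosed Y → LeftClosed (X ∧C Y)
  ∧C-leftClosed lx ly = record
    { ≡b-closed  = λ { (x , y) e → ≡b-closed lx x e , ≡b-closed ly y e }
    ; weaken     = λ { C (x , y) → weaken lx C x , weaken ly C y }
    ; ∧L-closed  = λ { C (x , y) → ∧L-closed lx C x , ∧L-closed ly C y }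
    ; ⇒L-closed  = λ { C d (x , y) → ⇒L-closed lx C d x , ⇒L-closed ly C d y }
    ; -∗L-closed = λ { C d (x , y) → -∗L-closed lx C d x , -∗L-closed ly C d y }
    }

  ⇒C-leftClosed : ∀ {X Y} → LeftClosed Y → LeftClosed (X ⇒C Y)
  ⇒C-leftClosed {X} {Y} ly =
    ⋂-leftClosed (λ Γ Δ → X Γ → Y (Δ ⨾ Γ)) λ Γ →
    ⋂-leftClosed (λ _ Δ → Y (Δ ⨾ Γ)) λ _ → ⨾-frame-leftClosed Γ ly

  -∗C-leftClosed : ∀ {X Y} → LeftClosed Y → LeftClosed (X -∗C Y)
  -∗C-leftClosed {X} {Y} ly =
    ⋂-leftClosed (λ Γ Δ → X Γ → Y (Δ ,ₘ Γ)) λ Γ →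
    ⋂-leftClosed (λ _ Δ → Y (Δ ,ₘ Γ)) λ _ → ,-frame-leftClosed Γ ly

  ⟦⟧-leftClosed : ∀ φ → LeftClosed ⟦ φ ⟧
  ⟦⟧-leftClosed top      = topC-leftClosed
  ⟦⟧-leftClosed bot      = cl-leftClosed _
  ⟦⟧-leftClosed (φ ∧f ψ) = ∧C-leftClosed (⟦⟧-leftClosed φ) (⟦⟧-leftClosed ψ)
  ⟦⟧-leftClosed (φ ∨f ψ) = cl-leftClosed _
  ⟦⟧-leftClosed (φ ⇒f ψ) = ⇒C-leftClosed (⟦⟧-leftClosed ψ)
  ⟦⟧-leftClosed emp      = cl-leftClosed _
  ⟦⟧-leftClosed (φ ∗f ψ) = cl-leftClosed _
  ⟦⟧-leftClosed (φ -∗ ψ) = -∗C-leftClosed (⟦⟧-leftClosed ψ)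
  ⟦⟧-leftClosed (atom a) = D-leftClosed _

  ⊢cf-top : (Δ : Bunch Atom) → Δ ⊢cf top
  ⊢cf-top Δ = equiv (W⨾ hole {Δ₂ = Δ} ⊤R) (≡b-trans (≡b-sym ⨾-unit) ⨾-comm)

  ⟦⟧⊆D : ∀ φ → ⟦ φ ⟧ ⊆ D φ
  fm∈⟦⟧ : ∀ φ → ⟦ φ ⟧ (fm φ)

  ⟦⟧⊆D top      Δ _       = ⊢cf-top Δ
  ⟦⟧⊆D bot      Δ x       = x bot λ _ ()
  ⟦⟧⊆D (φ ∧f ψ) Δ (x , y) = C⨾ hole (∧R (⟦⟧⊆D φ Δ x) (⟦⟧⊆D ψ Δ y))
  ⟦⟧⊆D (φ ∨f ψ) Δ x       = x (φ ∨f ψ) λ { Γ (inj₁ y) → ∨R1 (⟦⟧⊆D φ Γ y)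
                                           ; Γ (inj₂ z) → ∨R2 (⟦⟧⊆D ψ Γ z) }
  ⟦⟧⊆D (φ ⇒f ψ) Δ x       = ⇒R (⟦⟧⊆D ψ _ (x (fm φ) (fm∈⟦⟧ φ)))
  ⟦⟧⊆D emp      Δ x       = x emp λ _ → equiv empR
  ⟦⟧⊆D (φ ∗f ψ) Δ x       = x (φ ∗f ψ) λ { Γ (Δ₁ , Δ₂ , y , z , e) →
                              equiv (∗R (⟦⟧⊆D φ Δ₁ y) (⟦⟧⊆D ψ Δ₂ z)) e }
  ⟦⟧⊆D (φ -∗ ψ) Δ x       = -∗R (⟦⟧⊆D ψ _ (x (fm φ) (fm∈⟦⟧ φ)))
  ⟦⟧⊆D (atom a) Δ x       = x

  fm∈⟦⟧ top      = tt
  fm∈⟦⟧ bot      = λ _ _ → ⊥L hole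
  fm∈⟦⟧ (φ ∧f ψ) = ∧L-closed (⟦⟧-leftClosed φ) hole (weakenˡ (⟦⟧-leftClosed φ) {Γ = fm ψ} (fm∈⟦⟧ φ))
                 , ∧L-closed (⟦⟧-leftClosed ψ) hole (weakenʳ (⟦⟧-leftClosed ψ) {Γ = fm φ} (fm∈⟦⟧ ψ))
  fm∈⟦⟧ (φ ∨f ψ) = λ _ h → ∨L hole (h _ (inj₁ (fm∈⟦⟧ φ))) (h _ (inj₂ (fm∈⟦⟧ ψ)))
  fm∈⟦⟧ (φ ⇒f ψ) = λ Γ x → ⇒-apply (⟦⟧-leftClosed ψ) {ψ = ψ} (⟦⟧⊆D φ Γ x) (fm∈⟦⟧ ψ)
  fm∈⟦⟧ emp      = λ _ h → empL hole (h ∅m ≡b-refl)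
  fm∈⟦⟧ (φ ∗f ψ) = λ _ h → ∗L hole (h _ (fm φ , fm ψ , fm∈⟦⟧ φ , fm∈⟦⟧ ψ , ≡b-refl))
  fm∈⟦⟧ (φ -∗ ψ) = λ Γ x → -∗-apply (⟦⟧-leftClosed ψ) {ψ = ψ} (⟦⟧⊆D φ Γ x) (fm∈⟦⟧ ψ)
  fm∈⟦⟧ (atom a) = ax

  bunch∈⟦⌈⌉⟧ : ∀ Δ → ⟦ ⌈ Δ ⌉ ⟧ Δ
  bunch∈⟦⌈⌉⟧ (fm φ)   = fm∈⟦⟧ φ
  bunch∈⟦⌈⌉⟧ ∅m       = λ _ h → h ∅m ≡b-refl
  bunch∈⟦⌈⌉⟧ ∅a       = tt
  bunch∈⟦⌈⌉⟧ (Δ ,ₘ Γ) = λ _ h → h _ (Δ , Γ , bunch∈⟦⌈⌉⟧ Δ , bunch∈⟦⌈⌉⟧ Γ , ≡b-refl)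
  bunch∈⟦⌈⌉⟧ (Δ ⨾ Γ)  = weakenˡ (⟦⟧-leftClosed ⌈ Δ ⌉) {Γ = Γ} (bunch∈⟦⌈⌉⟧ Δ)
                      , weakenʳ (⟦⟧-leftClosed ⌈ Γ ⌉) {Γ = Δ} (bunch∈⟦⌈⌉⟧ Γ)

theorem6p7 : {Atom : Set} (Δ : Bunch Atom) (φ : Formula Atom) → ⟦ ⌈ Δ ⌉ ⟧ ⊆ ⟦ φ ⟧ → Δ ⊢cf φ
theorem6p7 Δ φ h = ⟦⟧⊆D φ Δ (h Δ (bunch∈⟦⌈⌉⟧ Δ))
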